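{- Let $t\in\mathbb{N}$ and $\vec r,\vec c\in\mathbb{N}^t$. If there exists a finite $(\vec r,\vec c)$-triangle-regular $t$-edge-colored graph, then there exist real numbers $x_{ijk}$, one for each multiset $\{i,j,k\}$ of size $3$ with elements from $\{1,\dots,t\}$ (so $x_{ijk}$ is symmetric in its indices), satisfying: (1) $x_{ijk}\ge 0$ for all $i,j,k$; (2) for all $i\ne j$: $\sum_{k\notin\{i,j\}} x_{ijk}+2x_{iij}+2x_{ijj}\le \vec r[i]\,\vec r[j]$; (3) for all $i$: $\sum_{k\ne i} x_{iik}+3x_{iii}\le \binom{\vec r[i]}{2}$; (4) for all $i$: $\sum_{\{j,k\}:\,j,k\ne i} x_{ijk}+2\sum_{j\ne i}x_{iij}+3x_{iii}=\vec c[i]$, where the first sum runs over multisets $\{j,k\}$ of size 2 with $j,k\in\{1,\dots,t\}\setminus\{i\}$ (allowing $j=k$).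
   Context: A $t$-edge-colored graph is a simple graph each of whose edges receives one of the colors $1,\dots,t$. It is $(\vec r,\vec c)$-triangle-regular if for every vertex $v$ and every color $i$, $v$ is incident to exactly $\vec r[i]$ edges of color $i$ and the open neighborhood $N(v)$ induces exactly $\vec c[i]$ edges of color $i$. -}

module Defs where

open import Data.Nat as ℕ using (ℕ; zero; suc)
open import Data.Nat.Combinatorics using (_C_)
open import Data.Integer using (+_)
open import Data.Fin as Fin using (Fin; zero; suc; _≟_)
open import Data.Maybe using (Maybe; just; nothing)
open import Data.Bool using (Bool; true; false; if_then_else_; _∧_; not)
open import Data.Product using (Σ; _×_; _,_)
open import Data.Rational as ℚ using (ℚ; 0ℚ; _+_; _*_; _/_)
open import Relation.Nullary.Decidable using (⌊_⌋)
open import Relation.Binary.PropositionalEquality using (_≡_; _≢_)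

count : ∀ {n} → (Fin n → Bool) → ℕ
count {zero}  f = 0
count {suc n} f = (if f zero then 1 else 0) ℕ.+ count (λ k → f (suc k))

countPairs : ∀ {m n} → (Fin m → Fin n → Bool) → ℕ
countPairs {zero}  f = 0
countPairs {suc m} f = count (f zero) ℕ.+ countPairs (λ u w → f (suc u) w)

sumF : ∀ {t} → (Fin t → ℚ) → ℚ
sumF {zero}  f = 0ℚ
sumF {suc t} f = f zero + sumF (λ k → f (suc k))

sumWhere : ∀ {t} → (Fin t → Bool) → (Fin t → ℚ) → ℚ
sumWhere P f = sumF (λ k → if P k then f k else 0ℚ)

ℕtoℚ : ℕ → ℚ
ℕtoℚ n = + n / 1

_==_ : ∀ {t} → Fin t → Fin t → Bool
i == j = ⌊ i ≟ j ⌋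

_=/=_ : ∀ {t} → Fin t → Fin t → Bool
i =/= j = not (i == j)

hasColour : ∀ {t} → Maybe (Fin t) → Fin t → Bool
hasColour nothing  i = false
hasColour (just j) i = j == i

-- A simple t-edge-coloured graph on vertex set Fin n:
-- col u v = nothing means no edge, col u v = just i means an edge of colour i.
-- Colours are 0-indexed (Fin t stands for {1,…,t}).
record EdgeColouredGraph (t n : ℕ) : Set where
  field
    col      : Fin n → Fin n → Maybe (Fin t)
    symmetric : ∀ u v → col u v ≡ col v u
    loopless  : ∀ v → col v v ≡ nothing

module _ {t n : ℕ} (G : EdgeColouredGraph t n) where
  open EdgeColouredGraph G

  adjacent : Fin n → Fin n → Bool
  adjacent u v with col u v
  ... | nothing = false
  ... | just _  = true

  colourDegree : Fin n → Fin t → ℕ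
  colourDegree v i = count (λ u → hasColour (col v u) i)

  -- number of edges of colour i inside the open neighbourhood N(v)
  -- (each unordered pair {u,w} counted once, via u < w)
  nbhdColourEdges : Fin n → Fin t → ℕ
  nbhdColourEdges v i =
    countPairs (λ u w →
      ⌊ u Fin.<? w ⌋ ∧ adjacent v u ∧ adjacent v w ∧ hasColour (col u w) i)

TriangleRegular : ∀ {t n} → (Fin t → ℕ) → (Fin t → ℕ) → EdgeColouredGraph t n → Set
TriangleRegular r c G =
  ∀ v i → colourDegree G v i ≡ r i × nbhdColourEdges G v i ≡ c i

-- x : Fin t → Fin t → Fin t → ℚ, symmetric in all indices (a value per 3-multiset)
Symmetric3 : ∀ {t} → (Fin t → Fin t → Fin t → ℚ) → Set
Symmetric3 x = ∀ i j k → x i j k ≡ x j i k × x i j k ≡ x i k j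

Feasible : ∀ {t} → (Fin t → ℕ) → (Fin t → ℕ) → (Fin t → Fin t → Fin t → ℚ) → Set
Feasible {t} r c x =
    (∀ i j k → 0ℚ ℚ.≤ x i j k)
  × (∀ i j → i ≢ j →
       (sumWhere (λ k → k =/= i ∧ k =/= j) (λ k → x i j k)
         + ℕtoℚ 2 * x i i j + ℕtoℚ 2 * x i j j)
       ℚ.≤ ℕtoℚ (r i ℕ.* r j))
  × (∀ i →
       (sumWhere (λ k → k =/= i) (λ k → x i i k) + ℕtoℚ 3 * x i i i)
       ℚ.≤ ℕtoℚ (r i C 2))
  × (∀ i →
       -- multisets {j,k} with j,k ≠ i, enumerated once via j ≤ k
       sumWhere (λ j → j =/= i) (λ j →
           sumWhere (λ k → k =/= i ∧ ⌊ j Fin.≤? k ⌋) (λ k → x i j k))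
       + ℕtoℚ 2 * sumWhere (λ j → j =/= i) (λ j → x i i j)
       + ℕtoℚ 3 * x i i i
       ≡ ℕtoℚ (c i))

{-# OPTIONS --safe #-}
module Submission where

-- Let n be the number of vertices and Δ i j k the number of ordered vertex triples (v, u, w)
-- with vu, vw, uw edges of colours i, j, k. A triangle with colour multiset {i, j, k}
-- contributes 6 / arrangements i j k to Δ i j k, so x = arrangements · Δ / 6n is symmetric
-- (it counts such triangles, divided by n). The left-hand sides of (2), (3), (4) become
-- 6 Σₖ Δ i j k, 3 Σₖ Δ i i k and 3 Σⱼₖ Δ i j k, and each is a double count over vertices v:
-- Σₖ Δ i j k counts the adjacent pairs (u, w) of an i-neighbour and a j-neighbour of v, at most
-- rᵢ rⱼ of them, or rᵢ (rᵢ − 1) when i = j since then u ≠ w; Σⱼₖ Δ j k i counts the ordered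
-- pairs of neighbours of v joined by an edge of colour i, exactly 2 cᵢ of them.

open import Defs
open import Data.Bool using (Bool; true; false; T; if_then_else_; _∧_; _∨_; not)
open import Data.Bool.Properties using (∨-comm; T-∧)
open import Data.Fin as Fin using (Fin; zero; suc; _≟_)
import Data.Fin.Properties as Finₚ
import Data.Integer as ℤ
import Data.Integer.Properties as ℤₚ
open import Data.Maybe using (just; nothing)
open import Data.Nat using (ℕ; zero; suc; _+_; _*_; _≤_; z≤n; s≤s)
open import Data.Nat.Coprimality using (1-coprimeTo) renaming (sym to coprime-sym)
open import Data.Nat.Combinatorics using (_C_; nC1≡n; nCk+nC[k+1]≡[n+1]C[k+1])
open import Data.Nat.Properties hiding (_≟_)
open import Data.Nat.Tactic.RingSolver using (solve-∀)
open import Data.Product using (Σ; _×_; _,_; proj₁; proj₂)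
open import Data.Rational as ℚ using (ℚ; 0ℚ; mkℚ; 1/_)
import Data.Rational.Properties as ℚₚ
open import Algebra.Properties.CommutativeSemigroup *-commutativeSemigroup
  using (x∙yz≈y∙xz; xy∙z≈xz∙y)
open import Algebra.Properties.Semiring.Sum +-*-semiring
open import Function using (_∘_; Equivalence)
open import Relation.Binary using (tri<; tri≈; tri>)
open import Relation.Binary.PropositionalEquality
open import Relation.Nullary using (Dec; ¬_; yes; no)
open import Relation.Nullary.Decidable
  using (⌊_⌋; ⌊⌋-map′; isYes≗does; dec-true; dec-false; toWitnessFalse)
open ≡-Reasoning

𝟙 : Bool → ℕ
𝟙 b = if b then 1 else 0

𝟙≤1 : ∀ b → 𝟙 b ≤ 1
𝟙≤1 false = z≤n
𝟙≤1 true  = s≤s z≤n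

𝟙-∧ : ∀ a b → 𝟙 (a ∧ b) ≡ 𝟙 a * 𝟙 b
𝟙-∧ false b = refl
𝟙-∧ true  b = sym (+-identityʳ (𝟙 b))

m*𝟙≤m : ∀ m b → m * 𝟙 b ≤ m
m*𝟙≤m m b = ≤-trans (*-monoʳ-≤ m (𝟙≤1 b)) (≤-reflexive (*-identityʳ m))

𝟙-idem : ∀ b → 𝟙 b * 𝟙 b ≡ 𝟙 b
𝟙-idem false = refl
𝟙-idem true  = refl

⌊⌋-true : ∀ {a} {A : Set a} (A? : Dec A) → A → ⌊ A? ⌋ ≡ true
⌊⌋-true A? x = trans (isYes≗does A?) (dec-true A? x)

⌊⌋-false : ∀ {a} {A : Set a} (A? : Dec A) → ¬ A → ⌊ A? ⌋ ≡ false
⌊⌋-false A? ¬x = trans (isYes≗does A?) (dec-false A? ¬x)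

module _ {t : ℕ} where

  ==-refl : ∀ (i : Fin t) → (i == i) ≡ true
  ==-refl i = ⌊⌋-true (i ≟ i) refl

  ==-≢ : ∀ {i j : Fin t} → i ≢ j → (i == j) ≡ false
  ==-≢ i≢j = ⌊⌋-false (_ ≟ _) i≢j

  ==-sym : ∀ (i j : Fin t) → (i == j) ≡ (j == i)
  ==-sym i j with i ≟ j
  ... | yes refl = sym (==-refl i)
  ... | no i≢j   = sym (==-≢ (i≢j ∘ sym))

  =/=⇒≢ : ∀ {i j : Fin t} → T (i =/= j) → i ≢ j
  =/=⇒≢ {i} {j} = toWitnessFalse {a? = i ≟ j}

==-suc : ∀ {t} (i j : Fin t) → (suc i == suc j) ≡ (i == j)
==-suc i j = ⌊⌋-map′ _ _ (i ≟ j)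

count≡∑ : ∀ {n} (f : Fin n → Bool) → count f ≡ ∑[ k < n ] 𝟙 (f k)
count≡∑ {zero}  f = refl
count≡∑ {suc n} f = cong (𝟙 (f zero) +_) (count≡∑ (f ∘ suc))

countPairs≡∑∑ : ∀ {m n} (f : Fin m → Fin n → Bool) →
  countPairs f ≡ ∑[ u < m ] ∑[ w < n ] 𝟙 (f u w)
countPairs≡∑∑ {zero}  f = refl
countPairs≡∑∑ {suc m} f = cong₂ _+_ (count≡∑ (f zero)) (countPairs≡∑∑ (f ∘ suc))

∑-const : ∀ n c → ∑[ k < n ] c ≡ n * c
∑-const zero    c = refl
∑-const (suc n) c = cong (c +_) (∑-const n c)

∑-mono-≤ : ∀ {n} {f g : Fin n → ℕ} → (∀ k → f k ≤ g k) → sum f ≤ sum g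
∑-mono-≤ {zero}  f≤g = z≤n
∑-mono-≤ {suc n} f≤g = +-mono-≤ (f≤g zero) (∑-mono-≤ (f≤g ∘ suc))

∑∑-product : ∀ {m n} (a : Fin m → ℕ) (b : Fin n → ℕ) →
  ∑[ u < m ] ∑[ w < n ] (a u * b w) ≡ sum a * sum b
∑∑-product a b = begin
  ∑[ u < _ ] ∑[ w < _ ] (a u * b w) ≡⟨ sum-cong-≗ (λ u → *-distribˡ-sum (a u) b) ⟨
  ∑[ u < _ ] (a u * sum b)          ≡⟨ *-distribʳ-sum (sum b) a ⟨
  sum a * sum b                     ∎

∑-inward₃ : ∀ {s a b c} (f : Fin s → Fin a → Fin b → Fin c → ℕ) →
  ∑[ x < s ] ∑[ v < a ] ∑[ u < b ] ∑[ w < c ] f x v u w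
    ≡ ∑[ v < a ] ∑[ u < b ] ∑[ w < c ] ∑[ x < s ] f x v u w
∑-inward₃ {s} {a} {b} {c} f = begin
  ∑[ x < s ] ∑[ v < a ] ∑[ u < b ] ∑[ w < c ] f x v u w
    ≡⟨ ∑-comm (λ x v → ∑[ u < b ] ∑[ w < c ] f x v u w) ⟩
  ∑[ v < a ] ∑[ x < s ] ∑[ u < b ] ∑[ w < c ] f x v u w
    ≡⟨ sum-cong-≗ (λ v → ∑-comm (λ x u → ∑[ w < c ] f x v u w)) ⟩
  ∑[ v < a ] ∑[ u < b ] ∑[ x < s ] ∑[ w < c ] f x v u w
    ≡⟨ sum-cong-≗ (λ v → sum-cong-≗ λ u → ∑-comm (λ x w → f x v u w)) ⟩
  ∑[ v < a ] ∑[ u < b ] ∑[ w < c ] ∑[ x < s ] f x v u w ∎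

if-∑ : ∀ {n} (b : Bool) (f : Fin n → ℕ) →
  (if b then sum f else 0) ≡ ∑[ k < n ] (if b then f k else 0)
if-∑     true  f = refl
if-∑ {n} false f = sym (sum-replicate-zero n)

∑-select : ∀ {n} (i : Fin n) (f : Fin n → ℕ) → ∑[ k < n ] (if i == k then f k else 0) ≡ f i
∑-select {suc n} zero    f = trans (cong (f zero +_) (sum-replicate-zero n)) (+-identityʳ (f zero))
∑-select {suc n} (suc i) f = begin
  ∑[ k < n ] (if suc i == suc k then f (suc k) else 0)
    ≡⟨ sum-cong-≗ (λ k → cong (λ b → if b then f (suc k) else 0) (==-suc i k)) ⟩
  ∑[ k < n ] (if i == k then f (suc k) else 0) ≡⟨ ∑-select i (f ∘ suc) ⟩
  f (suc i) ∎

∑-filter-split : ∀ {n} (P : Fin n → Bool) (i : Fin n) (f : Fin n → ℕ) →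
  ∑[ k < n ] (if P k then f k else 0)
    ≡ ∑[ k < n ] (if P k ∧ k =/= i then f k else 0) + (if P i then f i else 0)
∑-filter-split {n} P i f = begin
  sum g                                           ≡⟨ sum-cong-≗ split-at-i ⟩
  ∑[ k < n ] (h k + (if i == k then g k else 0))  ≡⟨ ∑-distrib-+ h (λ k → if i == k then g k else 0) ⟩
  sum h + ∑[ k < n ] (if i == k then g k else 0)  ≡⟨ cong (sum h +_) (∑-select i g) ⟩
  sum h + g i                                     ∎
  where
  g h : Fin n → ℕ
  g k = if P k then f k else 0
  h k = if P k ∧ k =/= i then f k else 0

  split-at-i : ∀ k → g k ≡ h k + (if i == k then g k else 0)
  split-at-i k rewrite ==-sym i k with P k | k == i
  ... | false | false = refl
  ... | false | true  = refl
  ... | true  | false = sym (+-identityʳ (f k))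
  ... | true  | true  = refl

∑-split : ∀ {n} (i : Fin n) (f : Fin n → ℕ) →
  sum f ≡ ∑[ k < n ] (if k =/= i then f k else 0) + f i
∑-split = ∑-filter-split (λ _ → true)

∑-filter-scale : ∀ {n} (P : Fin n → Bool) (c : ℕ) {f g : Fin n → ℕ} →
  (∀ k → T (P k) → f k ≡ c * g k) →
  ∑[ k < n ] (if P k then f k else 0) ≡ c * ∑[ k < n ] (if P k then g k else 0)
∑-filter-scale P c {f} {g} f≡cg =
  trans (sum-cong-≗ pointwise) (sym (*-distribˡ-sum c (λ k → if P k then g k else 0)))
  where
  pointwise : ∀ k → (if P k then f k else 0) ≡ c * (if P k then g k else 0)
  pointwise k with P k | f≡cg k
  ... | true  | eq = eq _
  ... | false | _  = sym (*-zeroʳ c)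

∑∑-offDiagonal : ∀ {n} (a b : Fin n → ℕ) →
  ∑[ u < n ] ∑[ w < n ] (if w =/= u then a u * b w else 0) + ∑[ u < n ] (a u * b u) ≡ sum a * sum b
∑∑-offDiagonal a b = begin
  ∑[ u < _ ] ∑[ w < _ ] (if w =/= u then a u * b w else 0) + ∑[ u < _ ] (a u * b u)
    ≡⟨ ∑-distrib-+ (λ u → ∑[ w < _ ] (if w =/= u then a u * b w else 0)) (λ u → a u * b u) ⟨
  ∑[ u < _ ] (∑[ w < _ ] (if w =/= u then a u * b w else 0) + a u * b u)
    ≡⟨ sum-cong-≗ (λ u → ∑-split u (λ w → a u * b w)) ⟨
  ∑[ u < _ ] ∑[ w < _ ] (a u * b w) ≡⟨ ∑∑-product a b ⟩
  sum a * sum b ∎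

∑∑-reweight : ∀ {n} (d : ℕ) (w F : Fin n → Fin n → ℕ) →
  (∀ j k → F j k ≡ F k j) →
  (∀ j k → (w j k + w k j) * F j k ≡ d * F j k) →
  2 * ∑[ j < n ] ∑[ k < n ] (w j k * F j k) ≡ d * ∑[ j < n ] ∑[ k < n ] F j k
∑∑-reweight {n} d w F F-sym weights = begin
  2 * S                                        ≡⟨ cong (S +_) (+-identityʳ S) ⟩
  S + S                                        ≡⟨ cong (S +_) (∑-comm (λ j k → w j k * F j k)) ⟩
  S + ∑[ j < n ] ∑[ k < n ] (w k j * F k j)
    ≡⟨ cong (S +_) (sum-cong-≗ λ j → sum-cong-≗ λ k → cong (w k j *_) (F-sym k j)) ⟩
  S + ∑[ j < n ] ∑[ k < n ] (w k j * F j k)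
    ≡⟨ ∑-distrib-+ (λ j → ∑[ k < n ] (w j k * F j k)) (λ j → ∑[ k < n ] (w k j * F j k)) ⟨
  ∑[ j < n ] (∑[ k < n ] (w j k * F j k) + ∑[ k < n ] (w k j * F j k))
    ≡⟨ sum-cong-≗ (λ j → ∑-distrib-+ (λ k → w j k * F j k) (λ k → w k j * F j k)) ⟨
  ∑[ j < n ] ∑[ k < n ] (w j k * F j k + w k j * F j k)
    ≡⟨ sum-cong-≗ (λ j → sum-cong-≗ λ k →
         trans (sym (*-distribʳ-+ (F j k) (w j k) (w k j))) (weights j k)) ⟩
  ∑[ j < n ] ∑[ k < n ] (d * F j k)            ≡⟨ sum-cong-≗ (λ j → *-distribˡ-sum d (F j)) ⟨
  ∑[ j < n ] (d * ∑[ k < n ] F j k)            ≡⟨ *-distribˡ-sum d (λ j → ∑[ k < n ] F j k) ⟨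
  d * ∑[ j < n ] ∑[ k < n ] F j k              ∎
  where S = ∑[ j < n ] ∑[ k < n ] (w j k * F j k)

-- Weighting triangle counts by arrangements

arrangements : ∀ {t} → Fin t → Fin t → Fin t → ℕ
arrangements i j k = if i == j then (if j == k then 1 else 3) else (if j == k ∨ i == k then 3 else 6)

module _ {t : ℕ} where

  arrangements-swap₁₂ : ∀ (i j k : Fin t) → arrangements i j k ≡ arrangements j i k
  arrangements-swap₁₂ i j k with i ≟ j
  ... | yes refl rewrite ==-refl i = refl
  ... | no i≢j rewrite ==-≢ (i≢j ∘ sym) =
    cong (λ b → if b then 3 else 6) (∨-comm (j == k) (i == k))

  arrangements-swap₂₃ : ∀ (i j k : Fin t) → arrangements i j k ≡ arrangements i k j
  arrangements-swap₂₃ i j k with j ≟ k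
  ... | yes refl rewrite ==-refl j = refl
  ... | no j≢k rewrite ==-≢ (j≢k ∘ sym) = swap-tests (i == j) (i == k)
    where
    swap-tests : ∀ a b → (if a then 3 else (if b then 3 else 6)) ≡ (if b then 3 else (if a then 3 else 6))
    swap-tests false false = refl
    swap-tests false true  = refl
    swap-tests true  false = refl
    swap-tests true  true  = refl

  arrangements-iii : ∀ (i : Fin t) → arrangements i i i ≡ 1
  arrangements-iii i rewrite ==-refl i = refl

  arrangements-iij : ∀ {i j : Fin t} → i ≢ j → arrangements i i j ≡ 3
  arrangements-iij {i} i≢j rewrite ==-refl i | ==-≢ i≢j = refl

  arrangements-ijj : ∀ {i j : Fin t} → i ≢ j → arrangements i j j ≡ 3
  arrangements-ijj {j = j} i≢j rewrite ==-≢ i≢j | ==-refl j = refl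

  arrangements-ijk : ∀ {i j k : Fin t} → i ≢ j → j ≢ k → i ≢ k → arrangements i j k ≡ 6
  arrangements-ijk i≢j j≢k i≢k rewrite ==-≢ i≢j | ==-≢ j≢k | ==-≢ i≢k = refl

  arrangements-ordered-pair : ∀ {i j k : Fin t} → i ≢ j → i ≢ k →
    𝟙 ⌊ j Fin.≤? k ⌋ * arrangements i j k + 𝟙 ⌊ k Fin.≤? j ⌋ * arrangements i k j ≡ 6
  arrangements-ordered-pair {i} {j} {k} i≢j i≢k with Finₚ.<-cmp j k
  ... | tri< j<k _ _
    rewrite ⌊⌋-true (j Fin.≤? k) (<⇒≤ j<k) | ⌊⌋-false (k Fin.≤? j) (<⇒≱ j<k)
          | arrangements-ijk i≢j (Finₚ.<⇒≢ j<k) i≢k = refl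
  ... | tri≈ _ refl _
    rewrite ⌊⌋-true (j Fin.≤? j) (Finₚ.≤-refl {x = j}) | arrangements-ijj i≢j = refl
  ... | tri> _ _ k<j
    rewrite ⌊⌋-false (j Fin.≤? k) (<⇒≱ k<j) | ⌊⌋-true (k Fin.≤? j) (<⇒≤ k<j)
          | arrangements-ijk i≢k (Finₚ.<⇒≢ k<j) i≢j = refl

-- The left-hand sides of constraints (2)–(4) of Feasible, evaluated on ℕ-valued weights.
module _ {t : ℕ} (X : Fin t → Fin t → Fin t → ℕ) where

  lhs₂ : Fin t → Fin t → ℕ
  lhs₂ i j = ∑[ k < t ] (if k =/= i ∧ k =/= j then X i j k else 0) + 2 * X i i j + 2 * X i j j

  lhs₃ : Fin t → ℕ
  lhs₃ i = ∑[ k < t ] (if k =/= i then X i i k else 0) + 3 * X i i i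

  lhs₄ : Fin t → ℕ
  lhs₄ i =
    ∑[ j < t ] (if j =/= i then ∑[ k < t ] (if k =/= i ∧ ⌊ j Fin.≤? k ⌋ then X i j k else 0) else 0)
    + 2 * ∑[ j < t ] (if j =/= i then X i i j else 0) + 3 * X i i i

module Weighted {t : ℕ} (Δ : Fin t → Fin t → Fin t → ℕ)
  (Δ-swap₁₂ : ∀ i j k → Δ i j k ≡ Δ j i k) (Δ-swap₂₃ : ∀ i j k → Δ i j k ≡ Δ i k j) where

  X : Fin t → Fin t → Fin t → ℕ
  X i j k = arrangements i j k * Δ i j k

  X-swap₁₂ : ∀ i j k → X i j k ≡ X j i k
  X-swap₁₂ i j k = cong₂ _*_ (arrangements-swap₁₂ i j k) (Δ-swap₁₂ i j k)

  X-swap₂₃ : ∀ i j k → X i j k ≡ X i k j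
  X-swap₂₃ i j k = cong₂ _*_ (arrangements-swap₂₃ i j k) (Δ-swap₂₃ i j k)

  ∑-X-iik : ∀ i →
    ∑[ k < t ] (if k =/= i then X i i k else 0) ≡ 3 * ∑[ k < t ] (if k =/= i then Δ i i k else 0)
  ∑-X-iik i = ∑-filter-scale (_=/= i) 3 λ k k≠i →
    cong (_* Δ i i k) (arrangements-iij (=/=⇒≢ k≠i ∘ sym))

  lhs₂-X : ∀ {i j} → i ≢ j → lhs₂ X i j ≡ 6 * ∑[ k < t ] Δ i j k
  lhs₂-X {i} {j} i≢j = begin
    lhs₂ X i j
      ≡⟨ cong (λ s → s + 2 * X i i j + 2 * X i j j) ∑-X-other ⟩
    6 * O + 2 * (arrangements i i j * Δ i i j) + 2 * (arrangements i j j * Δ i j j)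
      ≡⟨ cong₂ (λ a b → 6 * O + 2 * (a * Δ i i j) + 2 * (b * Δ i j j))
               (arrangements-iij i≢j) (arrangements-ijj i≢j) ⟩
    6 * O + 2 * (3 * Δ i i j) + 2 * (3 * Δ i j j)   ≡⟨ regroup O (Δ i i j) (Δ i j j) ⟩
    6 * (O + Δ i j j + Δ i i j)                    ≡⟨ cong (6 *_) ∑-Δ ⟨
    6 * ∑[ k < t ] Δ i j k                         ∎
    where
    O = ∑[ k < t ] (if k =/= i ∧ k =/= j then Δ i j k else 0)

    regroup : ∀ o a b → 6 * o + 2 * (3 * a) + 2 * (3 * b) ≡ 6 * (o + b + a)
    regroup = solve-∀

    ∑-X-other : ∑[ k < t ] (if k =/= i ∧ k =/= j then X i j k else 0) ≡ 6 * O
    ∑-X-other = ∑-filter-scale (λ k → k =/= i ∧ k =/= j) 6 λ k k∉ij →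
      let k≠i , k≠j = Equivalence.to (T-∧ {k =/= i} {k =/= j}) k∉ij in
      cong (_* Δ i j k) (arrangements-ijk i≢j (=/=⇒≢ k≠j ∘ sym) (=/=⇒≢ k≠i ∘ sym))

    ∑-Δ : ∑[ k < t ] Δ i j k ≡ O + Δ i j j + Δ i i j
    ∑-Δ = begin
      ∑[ k < t ] Δ i j k
        ≡⟨ ∑-split i (Δ i j) ⟩
      ∑[ k < t ] (if k =/= i then Δ i j k else 0) + Δ i j i
        ≡⟨ cong₂ _+_ (∑-filter-split (_=/= i) j (Δ i j)) (Δ-swap₂₃ i j i) ⟩
      O + (if j =/= i then Δ i j j else 0) + Δ i i j
        ≡⟨ cong (λ b → O + (if not b then Δ i j j else 0) + Δ i i j) (==-≢ (i≢j ∘ sym)) ⟩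
      O + Δ i j j + Δ i i j ∎

  lhs₃-X : ∀ i → lhs₃ X i ≡ 3 * ∑[ k < t ] Δ i i k
  lhs₃-X i = begin
    lhs₃ X i
      ≡⟨ cong₂ (λ s a → s + 3 * (a * Δ i i i)) (∑-X-iik i) (arrangements-iii i) ⟩
    3 * U + 3 * (1 * Δ i i i)               ≡⟨ cong (λ z → 3 * U + 3 * z) (*-identityˡ (Δ i i i)) ⟩
    3 * U + 3 * Δ i i i                     ≡⟨ *-distribˡ-+ 3 U (Δ i i i) ⟨
    3 * (U + Δ i i i)                       ≡⟨ cong (3 *_) (∑-split i (Δ i i)) ⟨
    3 * ∑[ k < t ] Δ i i k                  ∎
    where U = ∑[ k < t ] (if k =/= i then Δ i i k else 0)

  avoiding : Fin t → Fin t → Fin t → ℕ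
  avoiding i j k = if j =/= i then (if k =/= i then Δ i j k else 0) else 0

  avoiding-swap₂₃ : ∀ i j k → avoiding i j k ≡ avoiding i k j
  avoiding-swap₂₃ i j k = swap-tests (j =/= i) (k =/= i) (Δ-swap₂₃ i j k)
    where
    swap-tests : ∀ a b {v v′} → v ≡ v′ →
      (if a then (if b then v else 0) else 0) ≡ (if b then (if a then v′ else 0) else 0)
    swap-tests false false _  = refl
    swap-tests false true  _  = refl
    swap-tests true  false _  = refl
    swap-tests true  true  eq = eq

  ∑∑-Δ-split : ∀ i → ∑[ j < t ] ∑[ k < t ] Δ i j k ≡
    ∑[ j < t ] ∑[ k < t ] avoiding i j k + ∑[ k < t ] (if k =/= i then Δ i i k else 0)
      + (∑[ k < t ] (if k =/= i then Δ i i k else 0) + Δ i i i)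
  ∑∑-Δ-split i = begin
    ∑[ j < t ] ∑[ k < t ] Δ i j k              ≡⟨ sum-cong-≗ (λ j → ∑-split i (Δ i j)) ⟩
    ∑[ j < t ] (V j + Δ i j i)                 ≡⟨ ∑-distrib-+ V (λ j → Δ i j i) ⟩
    sum V + ∑[ j < t ] Δ i j i
      ≡⟨ cong₂ _+_ (∑-split i V) (sum-cong-≗ (λ j → Δ-swap₂₃ i j i)) ⟩
    ∑[ j < t ] (if j =/= i then V j else 0) + V i + ∑[ j < t ] Δ i i j
      ≡⟨ cong₂ (λ a b → a + V i + b)
           (sum-cong-≗ (λ j → if-∑ (j =/= i) (λ k → if k =/= i then Δ i j k else 0)))
           (∑-split i (Δ i i)) ⟩
    ∑[ j < t ] ∑[ k < t ] avoiding i j k + V i + (V i + Δ i i i) ∎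
    where
    V : Fin t → ℕ
    V j = ∑[ k < t ] (if k =/= i then Δ i j k else 0)

  -- The weights [j ≤ k] · arrangements i j k of (j, k) and (k, j) add up to 6 when j, k ≠ i
  -- (3 + 3 if j = k, 6 + 0 otherwise), so ∑∑-reweight applies.
  ∑∑-X-ordered : ∀ i →
    ∑[ j < t ] (if j =/= i then ∑[ k < t ] (if k =/= i ∧ ⌊ j Fin.≤? k ⌋ then X i j k else 0) else 0)
      ≡ 3 * ∑[ j < t ] ∑[ k < t ] avoiding i j k
  ∑∑-X-ordered i = begin
    ∑[ j < t ] (if j =/= i then ∑[ k < t ] (if k =/= i ∧ ⌊ j Fin.≤? k ⌋ then X i j k else 0) else 0)
      ≡⟨ sum-cong-≗ (λ j →
           trans (if-∑ (j =/= i) (λ k → if k =/= i ∧ ⌊ j Fin.≤? k ⌋ then X i j k else 0))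
           (sum-cong-≗ λ k → weigh (j =/= i) (k =/= i) ⌊ j Fin.≤? k ⌋ (arrangements i j k) (Δ i j k))) ⟩
    ∑[ j < t ] ∑[ k < t ] (weight j k * avoiding i j k)
      ≡⟨ *-cancelˡ-≡ _ _ 2 (trans (∑∑-reweight 6 weight (avoiding i) (avoiding-swap₂₃ i) weights-sum)
                                  (*-assoc 2 3 (∑[ j < t ] ∑[ k < t ] avoiding i j k))) ⟩
    3 * ∑[ j < t ] ∑[ k < t ] avoiding i j k ∎
    where
    weight : Fin t → Fin t → ℕ
    weight j k = 𝟙 ⌊ j Fin.≤? k ⌋ * arrangements i j k

    weigh : ∀ a b c A v →
      (if a then (if b ∧ c then A * v else 0) else 0) ≡ 𝟙 c * A * (if a then (if b then v else 0) else 0)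
    weigh false b     c     A v = sym (*-zeroʳ (𝟙 c * A))
    weigh true  false c     A v = sym (*-zeroʳ (𝟙 c * A))
    weigh true  true  false A v = refl
    weigh true  true  true  A v = cong (_* v) (sym (*-identityˡ A))

    weights-sum : ∀ j k → (weight j k + weight k j) * avoiding i j k ≡ 6 * avoiding i j k
    weights-sum j k = scale-tests (j =/= i) (k =/= i) (Δ i j k)
      (λ j≠i k≠i → arrangements-ordered-pair (=/=⇒≢ j≠i ∘ sym) (=/=⇒≢ k≠i ∘ sym))
      where
      scale-tests : ∀ a b v {y d} → (T a → T b → y ≡ d) →
        y * (if a then (if b then v else 0) else 0) ≡ d * (if a then (if b then v else 0) else 0)
      scale-tests false b     v {y} {d} _ = trans (*-zeroʳ y) (sym (*-zeroʳ d))
      scale-tests true  false v {y} {d} _ = trans (*-zeroʳ y) (sym (*-zeroʳ d))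
      scale-tests true  true  v         y≡d = cong (_* v) (y≡d _ _)

  lhs₄-X : ∀ i → lhs₄ X i ≡ 3 * ∑[ j < t ] ∑[ k < t ] Δ i j k
  lhs₄-X i = begin
    lhs₄ X i
      ≡⟨ cong₂ (λ s u → s + 2 * u + 3 * X i i i) (∑∑-X-ordered i) (∑-X-iik i) ⟩
    3 * M + 2 * (3 * U) + 3 * (arrangements i i i * Δ i i i)
      ≡⟨ cong (λ a → 3 * M + 2 * (3 * U) + 3 * (a * Δ i i i)) (arrangements-iii i) ⟩
    3 * M + 2 * (3 * U) + 3 * (1 * Δ i i i) ≡⟨ regroup M U (Δ i i i) ⟩
    3 * (M + U + (U + Δ i i i))             ≡⟨ cong (3 *_) (∑∑-Δ-split i) ⟨
    3 * ∑[ j < t ] ∑[ k < t ] Δ i j k       ∎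
    where
    M = ∑[ j < t ] ∑[ k < t ] avoiding i j k
    U = ∑[ k < t ] (if k =/= i then Δ i i k else 0)

    regroup : ∀ m u a → 3 * m + 2 * (3 * u) + 3 * (1 * a) ≡ 3 * (m + u + (u + a))
    regroup = solve-∀

-- Counting in an edge-coloured graph

2*nC2+n≡n*n : ∀ n → 2 * (n C 2) + n ≡ n * n
2*nC2+n≡n*n zero    = refl
2*nC2+n≡n*n (suc n) = begin
  2 * (suc n C 2) + suc n         ≡⟨ cong (λ c → 2 * c + suc n) (nCk+nC[k+1]≡[n+1]C[k+1] n 1) ⟨
  2 * (n C 1 + n C 2) + suc n     ≡⟨ cong (λ c → 2 * (c + n C 2) + suc n) (nC1≡n n) ⟩
  2 * (n + n C 2) + suc n         ≡⟨ regroup n (n C 2) ⟩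
  2 * (n C 2) + n + (n + suc n)   ≡⟨ cong (_+ (n + suc n)) (2*nC2+n≡n*n n) ⟩
  n * n + (n + suc n)             ≡⟨ square-suc n ⟩
  suc n * suc n                   ∎
  where
  regroup : ∀ n c → 2 * (n + c) + suc n ≡ 2 * c + n + (n + suc n)
  regroup = solve-∀
  square-suc : ∀ n → n * n + (n + suc n) ≡ suc n * suc n
  square-suc = solve-∀

module _ {t n : ℕ} (G : EdgeColouredGraph t n) where
  open EdgeColouredGraph G

  χ : Fin n → Fin n → Fin t → ℕ
  χ u v i = 𝟙 (hasColour (col u v) i)

  χ-sym : ∀ u v i → χ u v i ≡ χ v u i
  χ-sym u v i = cong (λ c → 𝟙 (hasColour c i)) (symmetric u v)

  χ-loop : ∀ u i → χ u u i ≡ 0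
  χ-loop u i = cong (λ c → 𝟙 (hasColour c i)) (loopless u)

  ∑-χ : ∀ u v → ∑[ i < t ] χ u v i ≡ 𝟙 (adjacent G u v)
  ∑-χ u v with col u v
  ... | nothing = sum-replicate-zero t
  ... | just c  = ∑-select c (λ _ → 1)

  ∑-χ≡colourDegree : ∀ v i → ∑[ u < n ] χ v u i ≡ colourDegree G v i
  ∑-χ≡colourDegree v i = sym (count≡∑ (λ u → hasColour (col v u) i))

  triangles : Fin t → Fin t → Fin t → ℕ
  triangles i j k = ∑[ v < n ] ∑[ u < n ] ∑[ w < n ] (χ v u i * χ v w j * χ u w k)

  triangles-swap₁₂ : ∀ i j k → triangles i j k ≡ triangles j i k
  triangles-swap₁₂ i j k = sum-cong-≗ λ v →
    trans (∑-comm (λ u w → χ v u i * χ v w j * χ u w k)) (sum-cong-≗ λ u → sum-cong-≗ λ w →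
      cong₂ _*_ (*-comm (χ v w i) (χ v u j)) (χ-sym w u k))

  triangles-swap₂₃ : ∀ i j k → triangles i j k ≡ triangles i k j
  triangles-swap₂₃ i j k =
    trans (∑-comm (λ v u → ∑[ w < n ] (χ v u i * χ v w j * χ u w k)))
          (sum-cong-≗ λ v → sum-cong-≗ λ u → sum-cong-≗ λ w →
            trans (cong (λ x → x * χ u w j * χ v w k) (χ-sym u v i))
                  (xy∙z≈xz∙y (χ v u i) (χ u w j) (χ v w k)))

  closedWedges : Fin n → Fin t → Fin t → ℕ
  closedWedges v i j = ∑[ u < n ] ∑[ w < n ] (χ v u i * χ v w j * 𝟙 (adjacent G u w))

  ∑-triangles≡∑-closedWedges : ∀ i j → ∑[ k < t ] triangles i j k ≡ ∑[ v < n ] closedWedges v i j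
  ∑-triangles≡∑-closedWedges i j = trans (∑-inward₃ (λ k v u w → χ v u i * χ v w j * χ u w k))
    (sum-cong-≗ λ v → sum-cong-≗ λ u → sum-cong-≗ λ w →
      trans (sym (*-distribˡ-sum (χ v u i * χ v w j) (χ u w))) (cong (χ v u i * χ v w j *_) (∑-χ u w)))

  closedWedges-≤ : ∀ v i j → closedWedges v i j ≤ colourDegree G v i * colourDegree G v j
  closedWedges-≤ v i j =
    ≤-trans (∑-mono-≤ λ u → ∑-mono-≤ λ w → m*𝟙≤m (χ v u i * χ v w j) (adjacent G u w))
            (≤-reflexive (trans (∑∑-product (λ u → χ v u i) (λ w → χ v w j))
                                (cong₂ _*_ (∑-χ≡colourDegree v i) (∑-χ≡colourDegree v j))))

  closedWedges-same-≤ : ∀ v i → closedWedges v i i ≤ 2 * (colourDegree G v i C 2)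
  closedWedges-same-≤ v i =
    ≤-trans (∑-mono-≤ λ u → ∑-mono-≤ λ w → closed⇒distinct u w (χ v u i * χ v w i))
            (≤-reflexive (trans distinctPairs (cong (λ d → 2 * (d C 2)) (∑-χ≡colourDegree v i))))
    where
    a = λ u → χ v u i
    closed⇒distinct : ∀ u w y → y * 𝟙 (adjacent G u w) ≤ (if w =/= u then y else 0)
    closed⇒distinct u w y with w ≟ u
    ... | yes refl rewrite loopless w = ≤-reflexive (*-zeroʳ y)
    ... | no _     = m*𝟙≤m y (adjacent G u w)
    distinct = ∑[ u < n ] ∑[ w < n ] (if w =/= u then a u * a w else 0)
    distinctPairs : distinct ≡ 2 * (sum a C 2)
    distinctPairs = +-cancelʳ-≡ (sum a) distinct (2 * (sum a C 2)) (begin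
      distinct + sum a
        ≡⟨ cong (distinct +_) (sum-cong-≗ λ u → 𝟙-idem (hasColour (col v u) i)) ⟨
      distinct + ∑[ u < n ] (a u * a u) ≡⟨ ∑∑-offDiagonal a a ⟩
      sum a * sum a                   ≡⟨ 2*nC2+n≡n*n (sum a) ⟨
      2 * (sum a C 2) + sum a         ∎)

  ∑∑-neighbourPairs : ∀ v i →
    ∑[ u < n ] ∑[ w < n ] (𝟙 (adjacent G v u) * (𝟙 (adjacent G v w) * χ u w i))
      ≡ 2 * nbhdColourEdges G v i
  ∑∑-neighbourPairs v i = sym (begin
    2 * nbhdColourEdges G v i
      ≡⟨ cong (2 *_) (countPairs≡∑∑ P) ⟩
    2 * ∑[ u < n ] ∑[ w < n ] 𝟙 (P u w)
      ≡⟨ cong (2 *_) (sum-cong-≗ λ u → sum-cong-≗ λ w →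
           𝟙-∧₄ ⌊ u Fin.<? w ⌋ (adjacent G v u) (adjacent G v w) (hasColour (col u w) i)) ⟩
    2 * ∑[ u < n ] ∑[ w < n ] (𝟙 ⌊ u Fin.<? w ⌋ * F u w)
      ≡⟨ ∑∑-reweight 1 (λ u w → 𝟙 ⌊ u Fin.<? w ⌋) F F-sym weights ⟩
    1 * ∑[ u < n ] ∑[ w < n ] F u w ≡⟨ *-identityˡ (∑[ u < n ] ∑[ w < n ] F u w) ⟩
    ∑[ u < n ] ∑[ w < n ] F u w ∎)
    where
    P : Fin n → Fin n → Bool
    P u w = ⌊ u Fin.<? w ⌋ ∧ adjacent G v u ∧ adjacent G v w ∧ hasColour (col u w) i

    F : Fin n → Fin n → ℕ
    F u w = 𝟙 (adjacent G v u) * (𝟙 (adjacent G v w) * χ u w i)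

    𝟙-∧₄ : ∀ a b c d → 𝟙 (a ∧ b ∧ c ∧ d) ≡ 𝟙 a * (𝟙 b * (𝟙 c * 𝟙 d))
    𝟙-∧₄ a b c d =
      trans (𝟙-∧ a (b ∧ c ∧ d)) (cong (𝟙 a *_) (trans (𝟙-∧ b (c ∧ d)) (cong (𝟙 b *_) (𝟙-∧ c d))))

    F-sym : ∀ u w → F u w ≡ F w u
    F-sym u w = trans (x∙yz≈y∙xz (𝟙 (adjacent G v u)) (𝟙 (adjacent G v w)) (χ u w i))
                      (cong (λ z → 𝟙 (adjacent G v w) * (𝟙 (adjacent G v u) * z)) (χ-sym u w i))

    F-diag : ∀ u → F u u ≡ 0
    F-diag u rewrite χ-loop u i | *-zeroʳ (𝟙 (adjacent G v u)) = *-zeroʳ (𝟙 (adjacent G v u))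

    weights : ∀ u w → (𝟙 ⌊ u Fin.<? w ⌋ + 𝟙 ⌊ w Fin.<? u ⌋) * F u w ≡ 1 * F u w
    weights u w with Finₚ.<-cmp u w
    ... | tri< u<w _ _ rewrite ⌊⌋-true (u Fin.<? w) u<w | ⌊⌋-false (w Fin.<? u) (<-asym u<w) = refl
    ... | tri> _ _ w<u rewrite ⌊⌋-false (u Fin.<? w) (<-asym w<u) | ⌊⌋-true (w Fin.<? u) w<u = refl
    ... | tri≈ _ refl _ rewrite F-diag u = *-zeroʳ (𝟙 ⌊ u Fin.<? u ⌋ + 𝟙 ⌊ u Fin.<? u ⌋)

  ∑∑-triangles≡2∑nbhdColourEdges : ∀ i →
    ∑[ j < t ] ∑[ k < t ] triangles j k i ≡ 2 * ∑[ v < n ] nbhdColourEdges G v i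
  ∑∑-triangles≡2∑nbhdColourEdges i = begin
    ∑[ j < t ] ∑[ k < t ] triangles j k i
      ≡⟨ sum-cong-≗ (λ j → ∑-inward₃ (λ k v u w → χ v u j * χ v w k * χ u w i)) ⟩
    ∑[ j < t ] ∑[ v < n ] ∑[ u < n ] ∑[ w < n ] ∑[ k < t ] (χ v u j * χ v w k * χ u w i)
      ≡⟨ ∑-inward₃ (λ j v u w → ∑[ k < t ] (χ v u j * χ v w k * χ u w i)) ⟩
    ∑[ v < n ] ∑[ u < n ] ∑[ w < n ] ∑[ j < t ] ∑[ k < t ] (χ v u j * χ v w k * χ u w i)
      ≡⟨ sum-cong-≗ (λ v → sum-cong-≗ λ u → sum-cong-≗ λ w → ∑∑-colours v u w) ⟩
    ∑[ v < n ] ∑[ u < n ] ∑[ w < n ] (𝟙 (adjacent G v u) * (𝟙 (adjacent G v w) * χ u w i))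
      ≡⟨ sum-cong-≗ (λ v → ∑∑-neighbourPairs v i) ⟩
    ∑[ v < n ] (2 * nbhdColourEdges G v i)
      ≡⟨ *-distribˡ-sum 2 (λ v → nbhdColourEdges G v i) ⟨
    2 * ∑[ v < n ] nbhdColourEdges G v i ∎
    where
    ∑∑-colours : ∀ v u w → ∑[ j < t ] ∑[ k < t ] (χ v u j * χ v w k * χ u w i)
                          ≡ 𝟙 (adjacent G v u) * (𝟙 (adjacent G v w) * χ u w i)
    ∑∑-colours v u w = begin
      ∑[ j < t ] ∑[ k < t ] (χ v u j * χ v w k * χ u w i)
        ≡⟨ sum-cong-≗ (λ j → *-distribʳ-sum (χ u w i) (λ k → χ v u j * χ v w k)) ⟨
      ∑[ j < t ] (∑[ k < t ] (χ v u j * χ v w k) * χ u w i)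
        ≡⟨ *-distribʳ-sum (χ u w i) (λ j → ∑[ k < t ] (χ v u j * χ v w k)) ⟨
      ∑[ j < t ] ∑[ k < t ] (χ v u j * χ v w k) * χ u w i
        ≡⟨ cong (_* χ u w i) (∑∑-product (χ v u) (χ v w)) ⟩
      ∑[ j < t ] χ v u j * ∑[ k < t ] χ v w k * χ u w i
        ≡⟨ cong₂ (λ a b → a * b * χ u w i) (∑-χ v u) (∑-χ v w) ⟩
      𝟙 (adjacent G v u) * 𝟙 (adjacent G v w) * χ u w i
        ≡⟨ *-assoc (𝟙 (adjacent G v u)) (𝟙 (adjacent G v w)) (χ u w i) ⟩
      𝟙 (adjacent G v u) * (𝟙 (adjacent G v w) * χ u w i) ∎

module _ {t n : ℕ} {r c : Fin t → ℕ} (G : EdgeColouredGraph t n) (regular : TriangleRegular r c G) where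

  ∑-triangles-≤ : ∀ i j → ∑[ k < t ] triangles G i j k ≤ n * (r i * r j)
  ∑-triangles-≤ i j = ≤-trans (≤-reflexive (∑-triangles≡∑-closedWedges G i j))
    (≤-trans (∑-mono-≤ λ v → ≤-trans (closedWedges-≤ G v i j)
                                    (≤-reflexive (cong₂ _*_ (proj₁ (regular v i)) (proj₁ (regular v j)))))
             (≤-reflexive (∑-const n (r i * r j))))

  ∑-triangles-same-≤ : ∀ i → ∑[ k < t ] triangles G i i k ≤ n * (2 * (r i C 2))
  ∑-triangles-same-≤ i = ≤-trans (≤-reflexive (∑-triangles≡∑-closedWedges G i i))
    (≤-trans (∑-mono-≤ λ v → ≤-trans (closedWedges-same-≤ G v i)
                                    (≤-reflexive (cong (λ d → 2 * (d C 2)) (proj₁ (regular v i)))))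
             (≤-reflexive (∑-const n (2 * (r i C 2)))))

  ∑∑-triangles≡n*2c : ∀ i → ∑[ j < t ] ∑[ k < t ] triangles G i j k ≡ n * (2 * c i)
  ∑∑-triangles≡n*2c i = begin
    ∑[ j < t ] ∑[ k < t ] triangles G i j k
      ≡⟨ sum-cong-≗ (λ j → sum-cong-≗ λ k →
           trans (triangles-swap₁₂ G i j k) (triangles-swap₂₃ G j i k)) ⟩
    ∑[ j < t ] ∑[ k < t ] triangles G j k i    ≡⟨ ∑∑-triangles≡2∑nbhdColourEdges G i ⟩
    2 * ∑[ v < n ] nbhdColourEdges G v i       ≡⟨ cong (2 *_) (sum-cong-≗ λ v → proj₂ (regular v i)) ⟩
    2 * ∑[ v < n ] c i                         ≡⟨ cong (2 *_) (∑-const n (c i)) ⟩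
    2 * (n * c i)                              ≡⟨ x∙yz≈y∙xz 2 n (c i) ⟩
    n * (2 * c i)                              ∎

-- Rescaling into ℚ

cong₃-+ : ∀ {a a′ b b′ c c′ : ℚ} → a ≡ a′ → b ≡ b′ → c ≡ c′ →
  a ℚ.+ b ℚ.+ c ≡ a′ ℚ.+ b′ ℚ.+ c′
cong₃-+ refl refl refl = refl

fromℕ : ℕ → ℚ
fromℕ n = mkℚ (ℤ.+ n) 0 (coprime-sym (1-coprimeTo n))

ℕtoℚ≡fromℕ : ∀ n → ℕtoℚ n ≡ fromℕ n
ℕtoℚ≡fromℕ n = ℚₚ.normalize-coprime (coprime-sym (1-coprimeTo n))

ℕtoℚ-+ : ∀ a b → ℕtoℚ (a + b) ≡ ℕtoℚ a ℚ.+ ℕtoℚ b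
ℕtoℚ-+ a b = begin
  ℕtoℚ (a + b)
    ≡⟨ cong (ℚ._/ 1) (cong₂ ℤ._+_ (sym (ℤₚ.*-identityʳ (ℤ.+ a))) (sym (ℤₚ.*-identityʳ (ℤ.+ b)))) ⟩
  fromℕ a ℚ.+ fromℕ b
    ≡⟨ cong₂ ℚ._+_ (ℕtoℚ≡fromℕ a) (ℕtoℚ≡fromℕ b) ⟨
  ℕtoℚ a ℚ.+ ℕtoℚ b ∎

ℕtoℚ-* : ∀ a b → ℕtoℚ (a * b) ≡ ℕtoℚ a ℚ.* ℕtoℚ b
ℕtoℚ-* a b = begin
  ℕtoℚ (a * b)         ≡⟨ cong (ℚ._/ 1) (ℤₚ.pos-* a b) ⟩
  fromℕ a ℚ.* fromℕ b  ≡⟨ cong₂ ℚ._*_ (ℕtoℚ≡fromℕ a) (ℕtoℚ≡fromℕ b) ⟨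
  ℕtoℚ a ℚ.* ℕtoℚ b    ∎

ℕtoℚ-mono-≤ : ∀ {a b} → a ≤ b → ℕtoℚ a ℚ.≤ ℕtoℚ b
ℕtoℚ-mono-≤ {a} {b} a≤b rewrite ℕtoℚ≡fromℕ a | ℕtoℚ≡fromℕ b =
  ℚ.*≤* (subst₂ ℤ._≤_ (sym (ℤₚ.*-identityʳ (ℤ.+ a))) (sym (ℤₚ.*-identityʳ (ℤ.+ b)))
                      (ℤ.+≤+ a≤b))

_/1+_ : ℕ → ℕ → ℚ
a /1+ d = ℕtoℚ a ℚ.* 1/ fromℕ (suc d)

module _ (d : ℕ) where
  private
    1/[1+d] : ℚ
    1/[1+d] = 1/ fromℕ (suc d)

  /1+-mono-≤ : ∀ {a b} → a ≤ b → a /1+ d ℚ.≤ b /1+ d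
  /1+-mono-≤ a≤b = ℚₚ.*-monoʳ-≤-nonNeg 1/[1+d] (ℕtoℚ-mono-≤ a≤b)

  /1+-nonNeg : ∀ a → 0ℚ ℚ.≤ a /1+ d
  /1+-nonNeg a = ℚₚ.≤-trans (ℚₚ.≤-reflexive (sym (ℚₚ.*-zeroˡ 1/[1+d]))) (/1+-mono-≤ {0} {a} z≤n)

  /1+-+ : ∀ a b → a /1+ d ℚ.+ b /1+ d ≡ (a + b) /1+ d
  /1+-+ a b = trans (sym (ℚₚ.*-distribʳ-+ 1/[1+d] (ℕtoℚ a) (ℕtoℚ b)))
                    (cong (ℚ._* 1/[1+d]) (sym (ℕtoℚ-+ a b)))

  ℕtoℚ-*-/1+ : ∀ c a → ℕtoℚ c ℚ.* (a /1+ d) ≡ (c * a) /1+ d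
  ℕtoℚ-*-/1+ c a = trans (sym (ℚₚ.*-assoc (ℕtoℚ c) (ℕtoℚ a) 1/[1+d]))
                         (cong (ℚ._* 1/[1+d]) (sym (ℕtoℚ-* c a)))

  *[1+d]-/1+ : ∀ c → (c * suc d) /1+ d ≡ ℕtoℚ c
  *[1+d]-/1+ c = begin
    ℕtoℚ (c * suc d) ℚ.* 1/[1+d]
      ≡⟨ cong (ℚ._* 1/[1+d]) (trans (ℕtoℚ-* c (suc d)) (cong (ℕtoℚ c ℚ.*_) (ℕtoℚ≡fromℕ (suc d)))) ⟩
    ℕtoℚ c ℚ.* [1+d] ℚ.* 1/[1+d]          ≡⟨ ℚₚ.*-assoc (ℕtoℚ c) [1+d] 1/[1+d] ⟩
    ℕtoℚ c ℚ.* ([1+d] ℚ.* 1/[1+d])        ≡⟨ cong (ℕtoℚ c ℚ.*_) (ℚₚ.*-inverseʳ [1+d]) ⟩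
    ℕtoℚ c ℚ.* ℚ.1ℚ                       ≡⟨ ℚₚ.*-identityʳ (ℕtoℚ c) ⟩
    ℕtoℚ c                                ∎
    where [1+d] = fromℕ (suc d)

  /1+-+₃ : ∀ a b c → a /1+ d ℚ.+ b /1+ d ℚ.+ c /1+ d ≡ (a + b + c) /1+ d
  /1+-+₃ a b c = trans (cong (ℚ._+ c /1+ d) (/1+-+ a b)) (/1+-+ (a + b) c)

  sumWhere-/1+ : ∀ {t} (P : Fin t → Bool) {f : Fin t → ℚ} (g : Fin t → ℕ) →
    (∀ k → f k ≡ g k /1+ d) →
    sumWhere P f ≡ (∑[ k < t ] (if P k then g k else 0)) /1+ d
  sumWhere-/1+ {zero}  P g f≡g = sym (ℚₚ.*-zeroˡ 1/[1+d])
  sumWhere-/1+ {suc t} P g f≡g =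
    trans (cong₂ ℚ._+_ (head (P zero) (f≡g zero)) (sumWhere-/1+ (P ∘ suc) (g ∘ suc) (f≡g ∘ suc)))
          (/1+-+ (if P zero then g zero else 0) _)
    where
    head : ∀ b {y a} → y ≡ a /1+ d → (if b then y else 0ℚ) ≡ (if b then a else 0) /1+ d
    head true  y≡a = y≡a
    head false _   = sym (ℚₚ.*-zeroˡ 1/[1+d])

feasible-/1+ : ∀ {t} (r c : Fin t → ℕ) (X : Fin t → Fin t → Fin t → ℕ) (d : ℕ) →
  (∀ i j → i ≢ j → lhs₂ X i j ≤ r i * r j * suc d) →
  (∀ i → lhs₃ X i ≤ (r i C 2) * suc d) →
  (∀ i → lhs₄ X i ≡ c i * suc d) →
  Feasible r c (λ i j k → X i j k /1+ d)
feasible-/1+ {t} r c X d bound₂ bound₃ count₄ =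
  (λ i j k → /1+-nonNeg d (X i j k)) ,
  (λ i j i≢j → ℚₚ.≤-trans (ℚₚ.≤-reflexive (lhs₂-/1+ i j))
                          (≤-/1+ (r i * r j) (bound₂ i j i≢j))) ,
  (λ i → ℚₚ.≤-trans (ℚₚ.≤-reflexive (lhs₃-/1+ i)) (≤-/1+ (r i C 2) (bound₃ i))) ,
  (λ i → trans (lhs₄-/1+ i) (trans (cong (_/1+ d) (count₄ i)) (*[1+d]-/1+ d (c i))))
  where
  x : Fin t → Fin t → Fin t → ℚ
  x i j k = X i j k /1+ d

  ≤-/1+ : ∀ {a} b → a ≤ b * suc d → a /1+ d ℚ.≤ ℕtoℚ b
  ≤-/1+ b a≤b[1+d] = ℚₚ.≤-trans (/1+-mono-≤ d a≤b[1+d]) (ℚₚ.≤-reflexive (*[1+d]-/1+ d b))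

  lhs₂-/1+ : ∀ i j →
    sumWhere (λ k → k =/= i ∧ k =/= j) (x i j) ℚ.+ ℕtoℚ 2 ℚ.* x i i j ℚ.+ ℕtoℚ 2 ℚ.* x i j j
      ≡ lhs₂ X i j /1+ d
  lhs₂-/1+ i j = trans
    (cong₃-+ (sumWhere-/1+ d (λ k → k =/= i ∧ k =/= j) (X i j) (λ _ → refl))
             (ℕtoℚ-*-/1+ d 2 (X i i j)) (ℕtoℚ-*-/1+ d 2 (X i j j)))
    (/1+-+₃ d (∑[ k < t ] (if k =/= i ∧ k =/= j then X i j k else 0)) (2 * X i i j) (2 * X i j j))

  lhs₃-/1+ : ∀ i → sumWhere (λ k → k =/= i) (x i i) ℚ.+ ℕtoℚ 3 ℚ.* x i i i ≡ lhs₃ X i /1+ d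
  lhs₃-/1+ i = trans
    (cong₂ ℚ._+_ (sumWhere-/1+ d (_=/= i) (X i i) (λ _ → refl)) (ℕtoℚ-*-/1+ d 3 (X i i i)))
    (/1+-+ d (∑[ k < t ] (if k =/= i then X i i k else 0)) (3 * X i i i))

  lhs₄-/1+ : ∀ i →
    sumWhere (λ j → j =/= i) (λ j → sumWhere (λ k → k =/= i ∧ ⌊ j Fin.≤? k ⌋) (λ k → x i j k))
      ℚ.+ ℕtoℚ 2 ℚ.* sumWhere (λ j → j =/= i) (λ j → x i i j) ℚ.+ ℕtoℚ 3 ℚ.* x i i i
      ≡ lhs₄ X i /1+ d
  lhs₄-/1+ i = trans
    (cong₃-+ (sumWhere-/1+ d (_=/= i) inner λ j →
                sumWhere-/1+ d (λ k → k =/= i ∧ ⌊ j Fin.≤? k ⌋) (X i j) (λ _ → refl))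
             (trans (cong (ℕtoℚ 2 ℚ.*_) (sumWhere-/1+ d (_=/= i) (X i i) (λ _ → refl)))
                    (ℕtoℚ-*-/1+ d 2 loops))
             (ℕtoℚ-*-/1+ d 3 (X i i i)))
    (/1+-+₃ d (∑[ j < t ] (if j =/= i then inner j else 0)) (2 * loops) (3 * X i i i))
    where
    inner : Fin t → ℕ
    inner j = ∑[ k < t ] (if k =/= i ∧ ⌊ j Fin.≤? k ⌋ then X i j k else 0)
    loops = ∑[ j < t ] (if j =/= i then X i i j else 0)

proposition5p1 : (t : ℕ) (r c : Fin t → ℕ) →
    (Σ ℕ λ m → Σ (EdgeColouredGraph t (suc m)) λ G → TriangleRegular r c G) →
    Σ (Fin t → Fin t → Fin t → ℚ) λ x → Symmetric3 x × Feasible r c x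
proposition5p1 t r c (m , G , regular) =
  (λ i j k → X i j k /1+ d) ,
  (λ i j k → cong (_/1+ d) (X-swap₁₂ i j k) , cong (_/1+ d) (X-swap₂₃ i j k)) ,
  feasible-/1+ r c X d
    (λ i j i≢j → ≤-trans (≤-reflexive (lhs₂-X i≢j))
                 (≤-trans (*-monoʳ-≤ 6 (∑-triangles-≤ G regular i j))
                          (≤-reflexive (rearrange₆ n (r i * r j)))))
    (λ i → ≤-trans (≤-reflexive (lhs₃-X i))
           (≤-trans (*-monoʳ-≤ 3 (∑-triangles-same-≤ G regular i))
                    (≤-reflexive (rearrange₃ n (r i C 2)))))
    (λ i → trans (lhs₄-X i) (trans (cong (3 *_) (∑∑-triangles≡n*2c G regular i)) (rearrange₃ n (c i))))
  where
  open Weighted (triangles G) (triangles-swap₁₂ G) (triangles-swap₂₃ G)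
  n = suc m
  -- suc d reduces to 6 * n
  d = m + 5 * n
  rearrange₆ : ∀ n a → 6 * (n * a) ≡ a * (6 * n)
  rearrange₆ = solve-∀
  rearrange₃ : ∀ n a → 3 * (n * (2 * a)) ≡ a * (6 * n)
  rearrange₃ = solve-∀
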